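{- Let $n,\alpha$ be integers with $n\ge 11$ and $2\le\alpha\le n-4$. Then \[ \frac{f_{\sf T}(n,\alpha)}{\alpha-1}\le\frac{2^{n-1}}{n-2}. \]
   Context: For integers $1\le\alpha\le n$, $f_{\sf T}(n,\alpha)$ is the number of stable sets (including the empty set) of the Turán graph $T_{n,\alpha}$, the disjoint union of $\alpha$ cliques whose orders sum to $n$ and differ pairwise by at most one; explicitly $f_{\sf T}(n,\alpha)=(\lceil n/\alpha\rceil+1)^p(\lfloor n/\alpha\rfloor+1)^{\alpha-p}$ with $p=n\bmod\alpha$. -}

module Defs where

open import Data.Nat using (ℕ; zero; suc; _+_; _*_; _∸_; _^_; NonZero)
open import Data.Nat.DivMod using (_/_; _%_)

ceilDiv : (n α : ℕ) → .{{_ : NonZero α}} → ℕ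
ceilDiv n α = (n + (α ∸ 1)) / α

-- f_T(n, α) = (⌈n/α⌉ + 1)^p (⌊n/α⌋ + 1)^(α - p),  p = n mod α :
-- the number of stable sets (incl. empty) of the Turán graph T_{n,α}.
fT : (n α : ℕ) → .{{_ : NonZero α}} → ℕ
fT n α = (ceilDiv n α + 1) ^ (n % α) * ((n / α) + 1) ^ (α ∸ (n % α))

module Submission where

-- Write n = p + q·α with 0 ≤ p < α.  The Turán graph T_{n,α} then has p
-- cliques of order q+1 and α−p of order q, so
--   f_T(n,α) = (q+2)^p (q+1)^(α−p)                          (turan q p α).
-- Adding one vertex enlarges a clique of order q to order q+1, which
-- multiplies f_T by (q+2)/(q+1); for n ≥ α (so q ≥ 1) this is at most 3/2.
-- Writing B(n,α) for the claim f_T(n,α)·(n−2) ≤ 2^(n−1)·(α−1), the factor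
-- 3/2 against the factor 2 of the right-hand side shows that B(n,α)
-- implies B(n+1,α) as soon as n ≥ 5 (since 3(n−1) ≤ 4(n−2)).  So it
-- suffices to check one starting value of n for each α:
--   * for α ≤ 6 the value n = 11, by direct computation;
--   * for α ≥ 7 the value n = α+4, where f_T(α+4,α) = 3^4·2^(α−4) and the
--     claim reduces to 81(α+2) ≤ 128(α−1).

open import Defs
open import Data.Nat using (ℕ; zero; suc; _+_; _*_; _∸_; _^_; _≤_; _<_; _≤′_; ≤′-refl; ≤′-step; NonZero; z≤n; s≤s; _≤?_)
open import Data.Nat.Properties
open import Data.Nat.DivMod
open import Data.Nat.Divisibility using (n∣m*n)
open import Data.Nat.Tactic.RingSolver using (solve-∀)
open import Data.Product using (_,_)
open import Data.Sum using (inj₁; inj₂)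
open import Relation.Binary.PropositionalEquality
open import Relation.Nullary using (yes; no)
open import Relation.Nullary.Decidable using (toWitness)

≤-by-gap : ∀ {m n} d → m + d ≡ n → m ≤ n
≤-by-gap {m} d refl = m≤m+n m d

quotient-of : ∀ p q α .{{_ : NonZero α}} → p < α → (p + q * α) / α ≡ q
quotient-of p q α p<α = begin
  (p + q * α) / α    ≡⟨ +-distrib-/-∣ʳ p (n∣m*n q) ⟩
  p / α + q * α / α  ≡⟨ cong₂ _+_ (m<n⇒m/n≡0 p<α) (m*n/n≡m q α) ⟩
  q                  ∎
  where open ≡-Reasoning

remainder-of : ∀ p q α .{{_ : NonZero α}} → p < α → (p + q * α) % α ≡ p
remainder-of p q α p<α = trans ([m+kn]%n≡m%n p q α) (m<n⇒m%n≡m p<α)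

ceilDiv-of : ∀ r q a → suc r < suc a → ceilDiv (suc r + q * suc a) (suc a) ≡ suc q
ceilDiv-of r q a (s≤s r<a) = begin
  (suc r + q * suc a + a) / suc a  ≡⟨ cong (_/ suc a) (regroup r q a) ⟩
  (r + suc q * suc a) / suc a      ≡⟨ quotient-of r (suc q) (suc a) (m≤n⇒m≤1+n r<a) ⟩
  suc q                            ∎
  where
  open ≡-Reasoning
  regroup : ∀ r q a → suc r + q * suc a + a ≡ r + suc q * suc a
  regroup = solve-∀

turan : (q p α : ℕ) → ℕ
turan q p α = (2 + q) ^ p * (1 + q) ^ (α ∸ p)

fT-profile : ∀ p q α .{{_ : NonZero α}} → p < α → fT (p + q * α) α ≡ turan q p α
fT-profile zero q α p<α
  rewrite remainder-of zero q α p<α | quotient-of zero q α p<α | +-comm q 1 = refl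
fT-profile (suc r) q (suc a) p<α
  rewrite remainder-of (suc r) q (suc a) p<α | quotient-of (suc r) q (suc a) p<α
        | ceilDiv-of r q a p<α | +-comm q 1 = refl

turan-wrap : ∀ q α → turan (suc q) 0 α ≡ turan q α α
turan-wrap q α rewrite n∸n≡0 α = trans (+-identityʳ _) (sym (*-identityʳ _))

fT-profile-suc : ∀ p q α .{{_ : NonZero α}} → p < α → fT (suc (p + q * α)) α ≡ turan q (suc p) α
fT-profile-suc p q α p<α with m≤n⇒m<n∨m≡n p<α
... | inj₁ sp<α = fT-profile (suc p) q α sp<α
... | inj₂ refl = trans (fT-profile 0 (suc q) α (s≤s z≤n)) (turan-wrap q α)

turan-shift : ∀ q p α → p < α → turan q (suc p) α * (1 + q) ≡ turan q p α * (2 + q)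
turan-shift q p (suc a) (s≤s p≤a) rewrite +-∸-assoc 1 p≤a =
  exchange ((2 + q) ^ p) ((1 + q) ^ (a ∸ p)) q
  where
  exchange : ∀ X Y q → (2 + q) * X * Y * (1 + q) ≡ X * ((1 + q) * Y) * (2 + q)
  exchange = solve-∀

fT-suc-ratio : ∀ n α .{{_ : NonZero α}} →
  fT (suc n) α * (1 + n / α) ≡ fT n α * (2 + n / α)
fT-suc-ratio n α =
  subst (λ m → fT (suc m) α * (1 + q) ≡ fT m α * (2 + q)) (sym (m≡m%n+[m/n]*n n α)) ratio
  where
  p = n % α
  q = n / α
  p<α : p < α
  p<α = m%n<n n α
  ratio : fT (suc (p + q * α)) α * (1 + q) ≡ fT (p + q * α) α * (2 + q)
  ratio rewrite fT-profile-suc p q α p<α | fT-profile p q α p<α = turan-shift q p α p<α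

growth-factor : ∀ q → 1 ≤ q → (2 + q) * 2 ≤ (1 + q) * 3
growth-factor (suc r) _ = ≤-by-gap r (gap r)
  where
  gap : ∀ r → (3 + r) * 2 + r ≡ (2 + r) * 3
  gap = solve-∀

-- Once every clique is nonempty, adding a vertex grows f_T by at most 3/2.
fT-suc-bound : ∀ n α .{{_ : NonZero α}} → α ≤ n → fT (suc n) α * 2 ≤ fT n α * 3
fT-suc-bound n α α≤n = *-cancelʳ-≤ _ _ (1 + q) (begin
  fT (suc n) α * 2 * (1 + q)  ≡⟨ swap (fT (suc n) α) 2 (1 + q) ⟩
  fT (suc n) α * (1 + q) * 2  ≡⟨ cong (_* 2) (fT-suc-ratio n α) ⟩
  fT n α * (2 + q) * 2        ≡⟨ *-assoc (fT n α) (2 + q) 2 ⟩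
  fT n α * ((2 + q) * 2)      ≤⟨ *-monoʳ-≤ (fT n α) (growth-factor q (m≥n⇒m/n>0 α≤n)) ⟩
  fT n α * ((1 + q) * 3)      ≡⟨ reorder (fT n α) (1 + q) 3 ⟩
  fT n α * 3 * (1 + q)        ∎)
  where
  open ≤-Reasoning
  q = n / α
  swap : ∀ x y z → x * y * z ≡ x * z * y
  swap = solve-∀
  reorder : ∀ x y z → x * (y * z) ≡ x * z * y
  reorder = solve-∀

Bound : (n α : ℕ) → .{{_ : NonZero α}} → Set
Bound n α = fT n α * (n ∸ 2) ≤ 2 ^ (n ∸ 1) * (α ∸ 1)

bound-step : ∀ n α .{{_ : NonZero α}} → 5 ≤ n → α ≤ n → Bound n α → Bound (suc n) α
bound-step (suc (suc t)) α (s≤s (s≤s 3≤t)) α≤n ih = *-cancelʳ-≤ _ _ 2 (begin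
  F′ * suc t * 2            ≡⟨ swap F′ (suc t) 2 ⟩
  F′ * 2 * suc t            ≤⟨ *-monoˡ-≤ (suc t) (fT-suc-bound (suc (suc t)) α α≤n) ⟩
  F * 3 * suc t             ≡⟨ *-assoc F 3 (suc t) ⟩
  F * (3 * suc t)           ≤⟨ *-monoʳ-≤ F (slack t 3≤t) ⟩
  F * (t * 4)               ≡⟨ sym (*-assoc F t 4) ⟩
  F * t * 4                 ≤⟨ *-monoˡ-≤ 4 ih ⟩
  B * A * 4                 ≡⟨ double B A ⟩
  2 * B * A * 2             ∎)
  where
  open ≤-Reasoning
  F = fT (suc (suc t)) α
  F′ = fT (suc (suc (suc t))) α
  B = 2 ^ suc t
  A = α ∸ 1
  swap : ∀ x y z → x * y * z ≡ x * z * y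
  swap = solve-∀
  double : ∀ b a → b * a * 4 ≡ 2 * b * a * 2
  double = solve-∀
  slack : ∀ t → 3 ≤ t → 3 * suc t ≤ t * 4
  slack t 3≤t = subst (λ u → 3 * suc u ≤ u * 4) (m∸n+n≡m 3≤t) (≤-by-gap (t ∸ 3) (gap (t ∸ 3)))
    where
    gap : ∀ s → 3 * suc (s + 3) + s ≡ (s + 3) * 4
    gap = solve-∀

bound-upward : ∀ {m n} α .{{_ : NonZero α}} → 5 ≤ m → α ≤ m → m ≤ n → Bound m α → Bound n α
bound-upward {m} α 5≤m α≤m m≤n base = from (≤⇒≤′ m≤n)
  where
  from : ∀ {n} → m ≤′ n → Bound n α
  from ≤′-refl = base
  from {suc n} (≤′-step m≤′n) =
    bound-step n α (≤-trans 5≤m m≤n′) (≤-trans α≤m m≤n′) (from m≤′n)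
    where m≤n′ = ≤′⇒≤ m≤′n

bound-small : ∀ α .{{_ : NonZero α}} → 2 ≤ α → α ≤ 6 → Bound 11 α
bound-small 2 _ _ = toWitness {a? = _ ≤? _} _
bound-small 3 _ _ = toWitness {a? = _ ≤? _} _
bound-small 4 _ _ = toWitness {a? = _ ≤? _} _
bound-small 5 _ _ = toWitness {a? = _ ≤? _} _
bound-small 6 _ _ = toWitness {a? = _ ≤? _} _
bound-small 1 (s≤s ()) _
bound-small (suc (suc (suc (suc (suc (suc (suc _))))))) _ (s≤s (s≤s (s≤s (s≤s (s≤s (s≤s ()))))))

-- Starting values for α = 7+k: n = α+4, where T_{n,α} has four edges and
-- f_T(α+4,α) = 81·2^(α−4); the claim is then 81(α+2) ≤ 128(α−1).
bound-large : ∀ k → Bound (11 + k) (7 + k)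
bound-large k = begin
  fT (11 + k) (7 + k) * (9 + k)  ≡⟨ cong (_* (9 + k)) fT-at-α+4 ⟩
  81 * X * (9 + k)      ≡⟨ regroup X k ⟩
  X * (81 * (9 + k))    ≤⟨ *-monoʳ-≤ X (≤-by-gap (39 + 47 * k) (gap k)) ⟩
  X * (128 * (6 + k))   ≡⟨ sym (regroup′ X k) ⟩
  2 ^ 7 * X * (6 + k)   ≡⟨ cong (_* (6 + k)) (sym (^-distribˡ-+-* 2 7 (3 + k))) ⟩
  2 ^ (10 + k) * (6 + k) ∎
  where
  open ≤-Reasoning
  X = 2 ^ (3 + k)
  fT-at-α+4 : fT (11 + k) (7 + k) ≡ 81 * X
  fT-at-α+4 = subst (λ m → fT m (7 + k) ≡ 81 * X) (cong (4 +_) (*-identityˡ (7 + k)))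
    (fT-profile 4 1 (7 + k) (s≤s (s≤s (s≤s (s≤s (s≤s z≤n))))))
  regroup : ∀ x k → 81 * x * (9 + k) ≡ x * (81 * (9 + k))
  regroup = solve-∀
  regroup′ : ∀ x k → 128 * x * (6 + k) ≡ x * (128 * (6 + k))
  regroup′ = solve-∀
  gap : ∀ k → 81 * (9 + k) + (39 + 47 * k) ≡ 128 * (6 + k)
  gap = solve-∀

lemma11 : (n α : ℕ) → .{{_ : NonZero α}} → 11 ≤ n → 2 ≤ α → α + 4 ≤ n →
    fT n α * (n ∸ 2) ≤ 2 ^ (n ∸ 1) * (α ∸ 1)
lemma11 n α 11≤n 2≤α α+4≤n with α ≤? 6
... | yes α≤6 =
  bound-upward α (m≤n+m 5 6) (≤-trans α≤6 (m≤m+n 6 5)) 11≤n (bound-small α 2≤α α≤6)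
... | no α≰6 with m≤n⇒∃[o]m+o≡n (≰⇒> α≰6)
...   | k , refl =
  bound-upward (7 + k) (m≤m+n 5 (6 + k)) (m≤n+m (7 + k) 4) 11+k≤n (bound-large k)
  where
  11+k≤n : 11 + k ≤ n
  11+k≤n = ≤-trans (≤-reflexive (cong (7 +_) (+-comm 4 k))) α+4≤n
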